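{- Let $w\in S_n$, $C$ a commutation class of reduced words for $w$, and $\rho:S_n\to\mathbb N$ a vote tally with $\operatorname{supp}(\rho)=\operatorname{Pre}(C)$. Then $\Sigma_\rho$ is strictly decreasing on $P_C$: $ab<_{P_C}cd$ implies $\Sigma_\rho(ab)>\Sigma_\rho(cd)$. Consequently, for every $r\in\mathbb R$: (i) the level set $A=\{ab\in\operatorname{Inv}(w):\Sigma_\rho(ab)=r\}$ is an antichain in $P_C$, and it has the form $A=\{a_1b_1,\dots,a_mb_m\}$ with $\{a_j,b_j\}\cap\{a_k,b_k\}=\varnothing$ for $j\neq k$; (ii) the set $\{ab\in\operatorname{Inv}(w):\Sigma_\rho(ab)\ge r\}$ is an order ideal of $P_C$, and equals $\operatorname{Inv}(v)$ for some $v\in\operatorname{Pre}(C)$; (iii) the set $\{ab\in\operatorname{Inv}(w):\Sigma_\rho(ab)> r\}$ is an order ideal of $P_C$, and equals $\operatorname{Inv}(u)$ for some $u\in\operatorname{Pre}(C)$.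
   Context: For $w=(w_1,\dots,w_n)\in S_n$, $<_w$ denotes the linear order $w_1<_w\cdots<_w w_n$ on $[n]$, and $\operatorname{Inv}(w)=\{(a,b):1\le a<b\le n,\ b<_w a\}$, pairs written $ab$. Let $s_i$ be the adjacent transposition of $i,i+1$; $ws_i$ is obtained from $w$ by swapping the entries in positions $i,i+1$. A reduced word for $w$ is $(i_1,\dots,i_\ell)$ with $w=s_{i_1}\cdots s_{i_\ell}$, $\ell=|\operatorname{Inv}(w)|$. The commutation class $C(\mathbf i)$ is the set of words obtained from $\mathbf i$ by repeatedly swapping adjacent entries differing by at least $2$. $\operatorname{Pre}(C)$ is the set of all $s_{i'_1}\cdots s_{i'_m}$ ($0\le m\le\ell$) with $(i'_1,\dots,i'_m)$ a prefix of a word in $C$. The heap poset $P_C$ on $\operatorname{Inv}(w)$: fix $\mathbf i\in C$, let $x_j$ be the unique element of $\operatorname{Inv}(s_{i_1}\cdots s_{i_j})\setminus\operatorname{Inv}(s_{i_1}\cdots s_{i_{j-1}})$; $P_C$ is the transitive closure of the relations $x_j<x_k$ for $j<k$ with $|i_j-i_k|\le 1$. A vote tally is $\rho:S_n\to\mathbb N$, $\operatorname{supp}(\rho)=\{w:\rho(w)>0\}$. The $\rho$-tally function is $\Sigma_\rho(ab)=\sum_{w'\in\operatorname{Pre}(C):\,ab\in\operatorname{Inv}(w')}\rho(w')$ for $ab\in\operatorname{Inv}(w)$. -}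

module Defs where

import Agda.Primitive

open import Data.Nat using (ℕ; zero; suc; _+_; _∸_; _≤_; _<_; _≡ᵇ_; ∣_-_∣; _<?_; _≤?_)
open import Data.Integer using (ℤ; +_) renaming (_≤_ to _≤ℤ_; _<_ to _<ℤ_)
open import Data.Bool using (if_then_else_)
open import Data.Nat.ListAction using (sum)
open import Data.List using (List; []; _∷_; length; map; filter; upTo; take; foldl; concatMap)
open import Data.List.Relation.Unary.All using (All)
open import Data.List.Relation.Binary.Permutation.Propositional using (_↭_)
open import Data.Product using (Σ; ∃; ∃-syntax; _×_; _,_; proj₁; proj₂)
open import Data.Product.Properties using ()
open import Relation.Nullary using (¬_; Dec)
open import Relation.Nullary.Decidable using (_×-dec_; ¬?)
open import Relation.Binary using (Rel)
open import Relation.Binary.PropositionalEquality using (_≡_; _≢_)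
open import Relation.Binary.Construct.Closure.ReflexiveTransitive using (Star)
open import Relation.Binary.Construct.Closure.Transitive using (TransClosure)

-- Permutations of [n] = {1,…,n} in one-line notation w = (w₁,…,wₙ),
-- represented as lists of natural numbers.

idPerm : ℕ → List ℕ
idPerm n = map suc (upTo n)

IsPerm : ℕ → List ℕ → Set
IsPerm n w = w ↭ idPerm n

-- position (0-based) of x in w (first occurrence)
pos : ℕ → List ℕ → ℕ
pos x [] = zero
pos x (y ∷ ys) = if x ≡ᵇ y then zero else suc (pos x ys)

_<[_]_ : ℕ → List ℕ → ℕ → Set
x <[ w ] y = pos x w < pos y w

InvPair : ℕ → List ℕ → ℕ → ℕ → Set
InvPair n w a b = (1 ≤ a) × (a < b) × (b ≤ n) × (b <[ w ] a)

invPair? : ∀ n w a b → Dec (InvPair n w a b)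
invPair? n w a b = (1 ≤? a) ×-dec ((suc a ≤? b) ×-dec ((b ≤? n) ×-dec (suc (pos b w) ≤? pos a w)))

allPairs : ℕ → List (ℕ × ℕ)
allPairs n = concatMap (λ a → map (λ b → (a , b)) (idPerm n)) (idPerm n)

invCount : ℕ → List ℕ → ℕ
invCount n w = length (filter (λ p → invPair? n w (proj₁ p) (proj₂ p)) (allPairs n))

-- w s_i : swap the entries in positions i , i+1 (1-based)
swapAt : ℕ → List ℕ → List ℕ
swapAt (suc zero) (x ∷ y ∷ r) = y ∷ x ∷ r
swapAt (suc (suc k)) (x ∷ r) = x ∷ swapAt (suc k) r
swapAt _ w = w

-- s_{i₁} ⋯ s_{iₘ} ∈ S_n  (= (((e s_{i₁}) s_{i₂}) ⋯) s_{iₘ})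
evalWord : ℕ → List ℕ → List ℕ
evalWord n is = foldl (λ v i → swapAt i v) (idPerm n) is

IsReducedWord : ℕ → List ℕ → List ℕ → Set
IsReducedWord n w is =
  All (λ i → (1 ≤ i) × (i < n)) is × (evalWord n is ≡ w) × (length is ≡ invCount n w)

data CommStep : Rel (List ℕ) Agda.Primitive.lzero where
  comm : ∀ (xs ys : List ℕ) i j → 2 ≤ ∣ i - j ∣ →
         CommStep (xs Data.List.++ i ∷ j ∷ ys) (xs Data.List.++ j ∷ i ∷ ys)

InClass : List ℕ → List ℕ → Set
InClass is js = Star CommStep is js

InPre : ℕ → List ℕ → List ℕ → Set
InPre n is v = ∃[ js ] ∃[ m ] (InClass is js × (m ≤ length js) × (v ≡ evalWord n (take m js)))

-- j-th letter (1-based) of a word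
letter : List ℕ → ℕ → ℕ
letter [] _ = zero
letter (x ∷ xs) (suc zero) = x
letter (x ∷ xs) (suc (suc k)) = letter xs (suc k)
letter (x ∷ xs) zero = zero

HeapLabel : ℕ → List ℕ → ℕ → ℕ × ℕ → Set
HeapLabel n is j (a , b) =
  (1 ≤ j) × (j ≤ length is) ×
  InvPair n (evalWord n (take j is)) a b ×
  ¬ InvPair n (evalWord n (take (j ∸ 1) is)) a b

HeapGen : ℕ → List ℕ → Rel (ℕ × ℕ) Agda.Primitive.lzero
HeapGen n is x y =
  ∃[ j ] ∃[ k ] ((j < k) × (∣ letter is j - letter is k ∣ ≤ 1) ×
                 HeapLabel n is j x × HeapLabel n is k y)

HeapLt : ℕ → List ℕ → Rel (ℕ × ℕ) Agda.Primitive.lzero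
HeapLt n is = TransClosure (HeapGen n is)

-- The ρ-tally function.  P is a duplicate-free list enumerating Pre(C).
-- Σ_ρ(ab) = Σ_{w' ∈ Pre(C), ab ∈ Inv(w')} ρ(w')

tally : ℕ → (List ℕ → ℕ) → List (List ℕ) → ℕ × ℕ → ℕ
tally n ρ P (a , b) = sum (map ρ (filter (λ v → invPair? n v a b) P))

IsAntichain : Rel (ℕ × ℕ) Agda.Primitive.lzero → ((ℕ × ℕ) → Set) → Set
IsAntichain _<P_ S = ∀ x y → S x → S y → ¬ (x <P y)

IsOrderIdeal : ℕ → List ℕ → Rel (ℕ × ℕ) Agda.Primitive.lzero → ((ℕ × ℕ) → Set) → Set
IsOrderIdeal n w _<P_ S =
  (∀ a b → S (a , b) → InvPair n w a b) ×
  (∀ x y → S x → InvPair n w (proj₁ y) (proj₂ y) → y <P x → S y)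

PairwiseDisjoint : ((ℕ × ℕ) → Set) → Set
PairwiseDisjoint S = ∀ a b c d → S (a , b) → S (c , d) → (a , b) ≢ (c , d) →
  (a ≢ c) × (a ≢ d) × (b ≢ c) × (b ≢ d)

module Submission where

-- Along a reduced word each letter adds exactly one inversion, the pair it exchanges; listing these
-- pairs labels the heap P_C, and the inversion set of the prefix of length m consists of the first m
-- labels. A commutation move only swaps labels whose letters are at distance at least 2, so two labels
-- related in P_C keep their order in every word of C: each prefix in Pre(C) inverting the larger one
-- inverts the smaller one, while the prefix ending with the smaller one does not invert the larger.
-- Hence Σ_ρ strictly decreases along P_C, its level sets are antichains and its upper sets are order
-- ideals; an order ideal can be commuted to the front of the word, so it is the inversion set of a
-- prefix. Finally, labels sharing a letter a are comparable: following the position of a along the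
-- word, each step moving a uses a letter adjacent to that of the previous step moving a.

open import Defs
open import Data.Bool using (true; false)
open import Data.Empty using (⊥; ⊥-elim)
open import Data.Integer using (ℤ; +_; +≤+) renaming (_≤_ to _≤ℤ_; _<_ to _<ℤ_)
import Data.Integer.Properties as ℤ
open import Data.List
  using (List; []; _∷_; _++_; length; map; filter; take; foldl; upTo; applyUpTo; concatMap; cartesianProduct)
open import Data.List.Membership.Propositional using (_∈_)
open import Data.List.Membership.Propositional.Properties using (∈-map⁻; ∈-upTo⁻; ∈-filter⁺; ∈-filter⁻)
open import Data.List.Properties
  using (length-map; length-upTo; filter-none; foldl-++; length-++; map-++; take-all; ∷-injective)
open import Data.List.Relation.Binary.Permutation.Propositional
  using (_↭_; ↭-sym; ↭-trans; prep; swap; ↭⇒↭ₛ) renaming (refl to ↭-refl)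
open import Data.List.Relation.Binary.Permutation.Propositional.Properties using (∈-resp-↭; ↭-length)
import Data.List.Relation.Binary.Permutation.Setoid.Properties as PermutationSetoid
open import Data.List.Relation.Unary.All using (All; []; _∷_)
open import Data.List.Relation.Unary.All.Properties using (All¬⇒¬Any; ++⁺; ++⁻)
import Data.List.Relation.Unary.All as All
open import Data.List.Relation.Unary.AllPairs using (_∷_)
open import Data.List.Relation.Unary.Any using (here; there)
open import Data.List.Relation.Unary.Unique.Propositional using (Unique)
open import Data.Maybe using (Maybe; just; nothing)
open import Data.Maybe.Properties using (just-injective)
import Data.List.Relation.Unary.Unique.Propositional.Properties as Unique
open import Data.Nat.ListAction using (sum)
open import Data.Nat
  using (ℕ; zero; suc; _+_; _∸_; _≤_; _<_; _≡ᵇ_; _⊓_; _⊔_; z≤n; s≤s; _≟_; _≤?_; ∣_-_∣)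
open import Data.Nat.Properties
open import Data.Product using (Σ; ∃-syntax; _×_; _,_; proj₁; proj₂)
import Data.Product
open import Data.Product.Properties using (≡-dec; ,-injective)
open import Data.Sum using (_⊎_; inj₁; inj₂)
import Data.Sum
open import Function using (_∘_; id)
open import Function.Bundles using (_⇔_; mk⇔; Equivalence)
open import Relation.Binary.Definitions using (tri<; tri≈; tri>)
open import Relation.Binary.PropositionalEquality
open import Relation.Binary.Construct.Closure.ReflexiveTransitive using (Star; ε; _◅_; _◅◅_; gmap)
open import Relation.Binary.Construct.Closure.Transitive using ([_]; _∷_; _∷ʳ_)
open import Relation.Nullary using (¬_; Dec; yes; no)
open import Relation.Nullary.Decidable using (¬?; _⊎-dec_)
open import Relation.Unary using (Decidable)

pos-head : ∀ x ys → pos x (x ∷ ys) ≡ 0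
pos-head x ys with x ≡ᵇ x | ≡⇒≡ᵇ x x refl
... | true | _ = refl

pos-tail : ∀ {x y} ys → x ≢ y → pos x (y ∷ ys) ≡ suc (pos x ys)
pos-tail {x} {y} ys x≢y with x ≡ᵇ y | ≡ᵇ⇒≡ x y
... | false | _  = refl
... | true  | eq = ⊥-elim (x≢y (eq _))

letter-∈ : ∀ v k → k < length v → letter v (suc k) ∈ v
letter-∈ (x ∷ v)     zero    _         = here refl
letter-∈ (x ∷ y ∷ v) (suc k) (s≤s k<) = there (letter-∈ (y ∷ v) k k<)

letter-suc-pred : ∀ v {i} → 1 ≤ i → letter v (suc (i ∸ 1)) ≡ letter v i
letter-suc-pred v {suc i} _ = refl

letter-pos : ∀ x v → pos x v < length v → letter v (suc (pos x v)) ≡ x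
letter-pos x (y ∷ v) lt with x ≟ y
... | yes refl rewrite pos-head x v = refl
... | no x≢y rewrite pos-tail v x≢y with v
...   | []     = ⊥-elim (<-irrefl refl (≤-trans lt (s≤s z≤n)))
...   | u ∷ v′ = letter-pos x (u ∷ v′) (≤-pred lt)

pos-letter : ∀ v k → Unique v → k < length v → pos (letter v (suc k)) v ≡ k
pos-letter (x ∷ v)     zero    _           _        = pos-head x v
pos-letter (x ∷ y ∷ v) (suc k) (x∉ ∷ uniq) (s≤s k<) =
  trans (pos-tail (y ∷ v) (λ e → All¬⇒¬Any x∉ (subst (_∈ y ∷ v) e (letter-∈ (y ∷ v) k k<))))
        (cong suc (pos-letter (y ∷ v) k uniq k<))

-- swapIndex i is the action of swapAt i on 0-based positions: it exchanges i ∸ 1 and i.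
swapIndex : ℕ → ℕ → ℕ
swapIndex zero          p             = p
swapIndex (suc zero)    zero          = 1
swapIndex (suc zero)    (suc zero)    = 0
swapIndex (suc zero)    (suc (suc p)) = suc (suc p)
swapIndex (suc (suc i)) zero          = zero
swapIndex (suc (suc i)) (suc p)       = suc (swapIndex (suc i) p)

swapIndex-involutive : ∀ i p → swapIndex i (swapIndex i p) ≡ p
swapIndex-involutive zero          p             = refl
swapIndex-involutive (suc zero)    zero          = refl
swapIndex-involutive (suc zero)    (suc zero)    = refl
swapIndex-involutive (suc zero)    (suc (suc p)) = refl
swapIndex-involutive (suc (suc i)) zero          = refl
swapIndex-involutive (suc (suc i)) (suc p)       = cong suc (swapIndex-involutive (suc i) p)

swapIndex-lower : ∀ i → 1 ≤ i → swapIndex i (i ∸ 1) ≡ i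
swapIndex-lower (suc zero)    _ = refl
swapIndex-lower (suc (suc i)) _ = cong suc (swapIndex-lower (suc i) (s≤s z≤n))

swapIndex-upper : ∀ i → 1 ≤ i → swapIndex i i ≡ i ∸ 1
swapIndex-upper (suc zero)    _ = refl
swapIndex-upper (suc (suc i)) _ = cong suc (swapIndex-upper (suc i) (s≤s z≤n))

swapIndex-fixed : ∀ i p → p ≢ i ∸ 1 → p ≢ i → swapIndex i p ≡ p
swapIndex-fixed zero          p             _    _    = refl
swapIndex-fixed (suc zero)    zero          ≢i-1 _    = ⊥-elim (≢i-1 refl)
swapIndex-fixed (suc zero)    (suc zero)    _    ≢i   = ⊥-elim (≢i refl)
swapIndex-fixed (suc zero)    (suc (suc p)) _    _    = refl
swapIndex-fixed (suc (suc i)) zero          _    _    = refl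
swapIndex-fixed (suc (suc i)) (suc p)       ≢i-1 ≢i   =
  cong suc (swapIndex-fixed (suc i) p (≢i-1 ∘ cong suc) (≢i ∘ cong suc))

swapIndex-mono-< : ∀ i p q → p < q → (p ≡ i ∸ 1 → q ≡ i → ⊥) → swapIndex i p < swapIndex i q
swapIndex-mono-< zero          p             q             p<q _  = p<q
swapIndex-mono-< (suc zero)    zero          (suc zero)    _   ex = ⊥-elim (ex refl refl)
swapIndex-mono-< (suc zero)    zero          (suc (suc q)) _   _  = s≤s (s≤s z≤n)
swapIndex-mono-< (suc zero)    (suc zero)    (suc (suc q)) _   _  = s≤s z≤n
swapIndex-mono-< (suc zero)    (suc (suc p)) (suc (suc q)) p<q _  = p<q
swapIndex-mono-< (suc zero)    (suc zero)    (suc zero)    (s≤s ()) _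
swapIndex-mono-< (suc zero)    (suc (suc p)) (suc zero)    (s≤s ()) _
swapIndex-mono-< (suc (suc i)) zero          (suc q)       _   _  = s≤s z≤n
swapIndex-mono-< (suc (suc i)) (suc p)       (suc q)       (s≤s p<q) ex =
  s≤s (swapIndex-mono-< (suc i) p q p<q (λ e₁ e₂ → ex (cong suc e₁) (cong suc e₂)))

swapIndex-reflects-< : ∀ i p q → 1 ≤ i → swapIndex i p < swapIndex i q → (p ≡ i → q ≡ i ∸ 1 → ⊥) → p < q
swapIndex-reflects-< i p q 1≤i lt ex =
  subst₂ _<_ (swapIndex-involutive i p) (swapIndex-involutive i q)
    (swapIndex-mono-< i _ _ lt λ e₁ e₂ →
      ex (moved p e₁ (swapIndex-lower i 1≤i)) (moved q e₂ (swapIndex-upper i 1≤i)))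
  where
  moved : ∀ p {r s} → swapIndex i p ≡ r → swapIndex i r ≡ s → p ≡ s
  moved p refl e = trans (sym (swapIndex-involutive i p)) e

pos-swapAt : ∀ x i v → Unique v → i < length v → pos x (swapAt i v) ≡ swapIndex i (pos x v)
pos-swapAt x zero v _ _ = refl
pos-swapAt x (suc zero) (y ∷ z ∷ r) ((y≢z ∷ _) ∷ _) _ with x ≟ z | x ≟ y
... | yes refl | yes refl = ⊥-elim (y≢z refl)
... | yes refl | no x≢y rewrite pos-head x (y ∷ r) | pos-tail (x ∷ r) x≢y | pos-head x r = refl
... | no x≢z   | yes refl rewrite pos-tail (x ∷ r) x≢z | pos-head x r | pos-head x (z ∷ r) = refl
... | no x≢z   | no x≢y rewrite pos-tail (y ∷ r) x≢z | pos-tail r x≢y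
                              | pos-tail (z ∷ r) x≢y | pos-tail r x≢z = refl
pos-swapAt x (suc (suc i)) (y ∷ z ∷ r) (_ ∷ uniq) (s≤s i<) with x ≟ y
... | yes refl rewrite pos-head x (swapAt (suc i) (z ∷ r)) | pos-head x (z ∷ r) = refl
... | no x≢y rewrite pos-tail (swapAt (suc i) (z ∷ r)) x≢y | pos-tail (z ∷ r) x≢y =
  cong suc (pos-swapAt x (suc i) (z ∷ r) uniq i<)
pos-swapAt x (suc zero)    (y ∷ []) _ (s≤s ())
pos-swapAt x (suc (suc i)) (y ∷ []) _ (s≤s ())

-- evalWord n is unfolds to act (idPerm n) is.
act : List ℕ → List ℕ → List ℕ
act = foldl (λ u i → swapAt i u)

adjPair : List ℕ → ℕ → ℕ × ℕ
adjPair v i = letter v i ⊓ letter v (suc i) , letter v i ⊔ letter v (suc i)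

_occursIn_ : ℕ → ℕ × ℕ → Set
a occursIn (x , y) = a ≡ x ⊎ a ≡ y

occursIn-sorted⁺ : ∀ {a} x y → a ≡ x ⊎ a ≡ y → a occursIn (x ⊓ y , x ⊔ y)
occursIn-sorted⁺ x y a≡ with ≤-total x y | a≡
... | inj₁ x≤y | inj₁ refl = inj₁ (sym (m≤n⇒m⊓n≡m x≤y))
... | inj₁ x≤y | inj₂ refl = inj₂ (sym (m≤n⇒m⊔n≡n x≤y))
... | inj₂ y≤x | inj₁ refl = inj₂ (sym (m≥n⇒m⊔n≡m y≤x))
... | inj₂ y≤x | inj₂ refl = inj₁ (sym (m≥n⇒m⊓n≡n y≤x))

occursIn-sorted⁻ : ∀ {a} x y → a occursIn (x ⊓ y , x ⊔ y) → a ≡ x ⊎ a ≡ y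
occursIn-sorted⁻ x y (inj₁ refl) = ⊓-sel x y
occursIn-sorted⁻ x y (inj₂ refl) = ⊔-sel x y

sorted-pair-< : ∀ {x y} → x < y → (x ⊓ y , x ⊔ y) ≡ (x , y)
sorted-pair-< x<y = cong₂ _,_ (m≤n⇒m⊓n≡m (<⇒≤ x<y)) (m≤n⇒m⊔n≡n (<⇒≤ x<y))

sorted-pair-> : ∀ {x y} → y < x → (x ⊓ y , x ⊔ y) ≡ (y , x)
sorted-pair-> y<x = cong₂ _,_ (m≥n⇒m⊓n≡n (<⇒≤ y<x)) (m≥n⇒m⊔n≡m (<⇒≤ y<x))

occurring-pair : ∀ {a b} p → proj₁ p ≤ proj₂ p → a < b → a occursIn p → b occursIn p → (a , b) ≡ p
occurring-pair p _   a<b (inj₁ refl) (inj₁ refl) = ⊥-elim (<-irrefl refl a<b)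
occurring-pair p _   _   (inj₁ refl) (inj₂ refl) = refl
occurring-pair p ≤p  a<b (inj₂ refl) (inj₁ refl) = ⊥-elim (<⇒≱ a<b ≤p)
occurring-pair p _   a<b (inj₂ refl) (inj₂ refl) = ⊥-elim (<-irrefl refl a<b)

occurs? : ∀ a p → Dec (a occursIn p)
occurs? a (x , y) = (a ≟ x) ⊎-dec (a ≟ y)

MovedBy : ℕ → ℕ → Set
MovedBy i p = p ≡ i ∸ 1 ⊎ p ≡ i

∣n-suc-n∣≡1 : ∀ m → ∣ m - suc m ∣ ≡ 1
∣n-suc-n∣≡1 zero    = refl
∣n-suc-n∣≡1 (suc m) = ∣n-suc-n∣≡1 m

MovedBy-close : ∀ {p i j} → 1 ≤ i → 1 ≤ j → MovedBy i p → MovedBy j p → ∣ i - j ∣ ≤ 1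
MovedBy-close {i = suc i} {suc j} _ _ (inj₁ refl) (inj₁ refl) = subst (_≤ 1) (sym (∣n-n∣≡0 i)) z≤n
MovedBy-close {i = suc i} {suc j} _ _ (inj₁ refl) (inj₂ refl) = ≤-reflexive (trans (∣-∣-comm (suc j) j) (∣n-suc-n∣≡1 j))
MovedBy-close {i = suc i} {suc j} _ _ (inj₂ refl) (inj₁ refl) = ≤-reflexive (∣n-suc-n∣≡1 i)
MovedBy-close {i = suc i} {suc j} _ _ (inj₂ refl) (inj₂ refl) = subst (_≤ 1) (sym (∣n-n∣≡0 i)) z≤n

idPerm-unique : ∀ n → Unique (idPerm n)
idPerm-unique n = Unique.map⁺ suc-injective (Unique.upTo⁺ n)

swapAt-↭ : ∀ i v → swapAt i v ↭ v
swapAt-↭ zero          v           = ↭-refl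
swapAt-↭ (suc zero)    []          = ↭-refl
swapAt-↭ (suc zero)    (x ∷ [])    = ↭-refl
swapAt-↭ (suc zero)    (x ∷ y ∷ r) = swap y x ↭-refl
swapAt-↭ (suc (suc i)) []          = ↭-refl
swapAt-↭ (suc (suc i)) (x ∷ r)     = prep x (swapAt-↭ (suc i) r)

module _ (n : ℕ) where

  Inv : List ℕ → ℕ × ℕ → Set
  Inv v x = InvPair n v (proj₁ x) (proj₂ x)

  inv? : ∀ v → Decidable (Inv v)
  inv? v x = invPair? n v (proj₁ x) (proj₂ x)

  IsPerm⇒Unique : ∀ {v} → IsPerm n v → Unique v
  IsPerm⇒Unique v↭ = PermutationSetoid.Unique-resp-↭ (setoid ℕ) (↭⇒↭ₛ (↭-sym v↭)) (idPerm-unique n)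

  IsPerm⇒length : ∀ {v} → IsPerm n v → length v ≡ n
  IsPerm⇒length v↭ = trans (↭-length v↭) (trans (length-map suc (upTo n)) (length-upTo n))

  letter-bounds : ∀ {v} → IsPerm n v → ∀ k → k < n → 1 ≤ letter v (suc k) × letter v (suc k) ≤ n
  letter-bounds {v} v↭ k k<n
    with ∈-map⁻ suc (∈-resp-↭ v↭ (letter-∈ v k (subst (k <_) (sym (IsPerm⇒length v↭)) k<n)))
  ... | y , y∈ , e rewrite e = s≤s z≤n , ∈-upTo⁻ y∈

  swapAt-isPerm : ∀ {v} i → IsPerm n v → IsPerm n (swapAt i v)
  swapAt-isPerm i v↭ = ↭-trans (swapAt-↭ i _) v↭

  act-isPerm : ∀ {v} is → IsPerm n v → IsPerm n (act v is)
  act-isPerm []       v↭ = v↭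
  act-isPerm (i ∷ is) v↭ = act-isPerm is (swapAt-isPerm i v↭)

  module Adjacent {v} (v↭ : IsPerm n v) {i} (1≤i : 1 ≤ i) (i<n : i < n) where

    private
      uniq : Unique v
      uniq = IsPerm⇒Unique v↭
      <length : ∀ {k} → k < n → k < length v
      <length = subst (_ <_) (sym (IsPerm⇒length v↭))
      i-1<i : i ∸ 1 < i
      i-1<i = ∸-monoʳ-< (s≤s z≤n) 1≤i
      i-1<n : i ∸ 1 < n
      i-1<n = <-trans i-1<i i<n
      letter-pred : letter v (suc (i ∸ 1)) ≡ letter v i
      letter-pred = letter-suc-pred v 1≤i
      pos-swapAt′ : ∀ a → pos a (swapAt i v) ≡ swapIndex i (pos a v)
      pos-swapAt′ a = pos-swapAt a i v uniq (<length i<n)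

      x y : ℕ
      x = letter v i
      y = letter v (suc i)
      x-bounds : 1 ≤ x × x ≤ n
      x-bounds = subst (λ z → 1 ≤ z × z ≤ n) letter-pred (letter-bounds v↭ (i ∸ 1) i-1<n)
      y-bounds : 1 ≤ y × y ≤ n
      y-bounds = letter-bounds v↭ i i<n
      pos-x : pos x v ≡ i ∸ 1
      pos-x = subst (λ z → pos z v ≡ i ∸ 1) letter-pred (pos-letter v (i ∸ 1) uniq (<length i-1<n))
      pos-y : pos y v ≡ i
      pos-y = pos-letter v i uniq (<length i<n)
      pos-swapAt-x : pos x (swapAt i v) ≡ i
      pos-swapAt-x = trans (pos-swapAt′ x) (trans (cong (swapIndex i) pos-x) (swapIndex-lower i 1≤i))
      pos-swapAt-y : pos y (swapAt i v) ≡ i ∸ 1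
      pos-swapAt-y = trans (pos-swapAt′ y) (trans (cong (swapIndex i) pos-y) (swapIndex-upper i 1≤i))

    occurs⇒MovedBy : ∀ a → a occursIn adjPair v i → MovedBy i (pos a v)
    occurs⇒MovedBy a occ with occursIn-sorted⁻ x y occ
    ... | inj₁ refl = inj₁ pos-x
    ... | inj₂ refl = inj₂ pos-y

    MovedBy⇒occurs : ∀ a → MovedBy i (pos a v) → a occursIn adjPair v i
    MovedBy⇒occurs a moved =
      occursIn-sorted⁺ x y (Data.Sum.map (λ e → trans (letter-at i-1<n e) letter-pred) (letter-at i<n) moved)
      where
      letter-at : ∀ {k} → k < n → pos a v ≡ k → a ≡ letter v (suc k)
      letter-at k<n refl = sym (letter-pos a v (<length k<n))

    MovedBy⇒adjPair : ∀ {a b} → a < b → MovedBy i (pos a v) → MovedBy i (pos b v) → (a , b) ≡ adjPair v i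
    MovedBy⇒adjPair a<b a-moved b-moved =
      occurring-pair (adjPair v i) (m⊓n≤m⊔n x y) a<b (MovedBy⇒occurs _ a-moved) (MovedBy⇒occurs _ b-moved)

    inv-swapAt⁺ : ∀ {a b} → (a , b) ≢ adjPair v i → InvPair n v a b → InvPair n (swapAt i v) a b
    inv-swapAt⁺ {a} {b} ≢adj (1≤a , a<b , b≤n , b<a) =
      1≤a , a<b , b≤n ,
      subst₂ _<_ (sym (pos-swapAt′ b)) (sym (pos-swapAt′ a))
        (swapIndex-mono-< i _ _ b<a λ eb ea → ≢adj (MovedBy⇒adjPair a<b (inj₂ ea) (inj₁ eb)))

    inv-swapAt⁻ : ∀ {a b} → (a , b) ≢ adjPair v i → InvPair n (swapAt i v) a b → InvPair n v a b
    inv-swapAt⁻ {a} {b} ≢adj (1≤a , a<b , b≤n , b<a) =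
      1≤a , a<b , b≤n ,
      swapIndex-reflects-< i _ _ 1≤i (subst₂ _<_ (pos-swapAt′ b) (pos-swapAt′ a) b<a)
        λ eb ea → ≢adj (MovedBy⇒adjPair a<b (inj₁ ea) (inj₂ eb))

    inv-swapAt-adjPair : ¬ Inv v (adjPair v i) → Inv (swapAt i v) (adjPair v i)
    inv-swapAt-adjPair ¬inv with <-cmp x y
    ... | tri< x<y _ _ =
      subst (Inv (swapAt i v)) (sym (sorted-pair-< x<y))
        (proj₁ x-bounds , x<y , proj₂ y-bounds , subst₂ _<_ (sym pos-swapAt-y) (sym pos-swapAt-x) i-1<i)
    ... | tri≈ _ x≡y _ = ⊥-elim (<-irrefl (trans (sym pos-x) (trans (cong (λ z → pos z v) x≡y) pos-y)) i-1<i)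
    ... | tri> _ _ y<x =
      ⊥-elim (¬inv (subst (Inv v) (sym (sorted-pair-> y<x))
        (proj₁ y-bounds , y<x , proj₂ x-bounds , subst₂ _<_ (sym pos-x) (sym pos-y) i-1<i)))

    MovedBy-swapAt : ∀ a → MovedBy i (pos a v) → MovedBy i (pos a (swapAt i v))
    MovedBy-swapAt a (inj₁ e) = inj₂ (trans (pos-swapAt′ a) (trans (cong (swapIndex i) e) (swapIndex-lower i 1≤i)))
    MovedBy-swapAt a (inj₂ e) = inj₁ (trans (pos-swapAt′ a) (trans (cong (swapIndex i) e) (swapIndex-upper i 1≤i)))

    pos-swapAt-unmoved : ∀ a → ¬ a occursIn adjPair v i → pos a (swapAt i v) ≡ pos a v
    pos-swapAt-unmoved a ¬occ =
      trans (pos-swapAt′ a)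
            (swapIndex-fixed i _ (¬occ ∘ MovedBy⇒occurs a ∘ inj₁) (¬occ ∘ MovedBy⇒occurs a ∘ inj₂))

-- Reduced words add one inversion at each step

module _ {X : Set} {P Q : X → Set} (P? : Decidable P) (Q? : Decidable Q) where

  length-filter-⊆ : ∀ xs → (∀ x → x ∈ xs → P x → Q x) → length (filter P? xs) ≤ length (filter Q? xs)
  length-filter-⊆ []       _   = z≤n
  length-filter-⊆ (x ∷ xs) P⊆Q with P? x | Q? x
  ... | yes _ | yes _ = s≤s (length-filter-⊆ xs (λ y → P⊆Q y ∘ there))
  ... | yes p | no ¬q = ⊥-elim (¬q (P⊆Q x (here refl) p))
  ... | no _  | yes _ = m≤n⇒m≤1+n (length-filter-⊆ xs (λ y → P⊆Q y ∘ there))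
  ... | no _  | no _  = length-filter-⊆ xs (λ y → P⊆Q y ∘ there)

  length-filter-⊆-suc : ∀ xs x₀ → Unique xs → (∀ x → P x → Q x ⊎ x ≡ x₀) →
                        length (filter P? xs) ≤ suc (length (filter Q? xs))
  length-filter-⊆-suc []       _  _            _   = z≤n
  length-filter-⊆-suc (x ∷ xs) x₀ (x∉ ∷ uniq) P⊆Q+x₀ with P? x | Q? x
  ... | yes _ | yes _ = s≤s (length-filter-⊆-suc xs x₀ uniq P⊆Q+x₀)
  ... | no _  | yes _ = m≤n⇒m≤1+n (length-filter-⊆-suc xs x₀ uniq P⊆Q+x₀)
  ... | no _  | no _  = length-filter-⊆-suc xs x₀ uniq P⊆Q+x₀
  ... | yes p | no ¬q with P⊆Q+x₀ x p
  ...   | inj₁ q    = ⊥-elim (¬q q)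
  ...   | inj₂ refl = s≤s (length-filter-⊆ xs P⊆Q)
    where
    P⊆Q : ∀ y → y ∈ xs → P y → Q y
    P⊆Q y y∈ py with P⊆Q+x₀ y py
    ... | inj₁ qy   = qy
    ... | inj₂ refl = ⊥-elim (All¬⇒¬Any x∉ y∈)

concatMap-pairs≡cartesianProduct : ∀ {X Y : Set} (xs : List X) (ys : List Y) →
  concatMap (λ a → map (λ b → a , b) ys) xs ≡ cartesianProduct xs ys
concatMap-pairs≡cartesianProduct []       ys = refl
concatMap-pairs≡cartesianProduct (x ∷ xs) ys = cong (map (x ,_) ys ++_) (concatMap-pairs≡cartesianProduct xs ys)

allPairs-unique : ∀ n → Unique (allPairs n)
allPairs-unique n = subst Unique (sym (concatMap-pairs≡cartesianProduct (idPerm n) (idPerm n)))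
  (Unique.cartesianProduct⁺ (idPerm-unique n) (idPerm-unique n))

_≟²_ : (x y : ℕ × ℕ) → Dec (x ≡ y)
_≟²_ = ≡-dec _≟_ _≟_

pos-map-suc-applyUpTo : ∀ (g : ℕ → ℕ) → (∀ {x y} → g x ≡ g y → x ≡ y) → ∀ m k → k < m →
                        pos (suc (g k)) (map suc (applyUpTo g m)) ≡ k
pos-map-suc-applyUpTo g g-inj (suc m) zero    _         = pos-head _ (map suc (applyUpTo (g ∘ suc) m))
pos-map-suc-applyUpTo g g-inj (suc m) (suc k) (s≤s k<m) =
  trans (pos-tail (map suc (applyUpTo (g ∘ suc) m)) λ e → 0≢1+n (sym (g-inj (suc-injective e))))
        (cong suc (pos-map-suc-applyUpTo (g ∘ suc) (λ e → suc-injective (g-inj e)) m k k<m))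

pos-idPerm : ∀ n k → k < n → pos (suc k) (idPerm n) ≡ k
pos-idPerm = pos-map-suc-applyUpTo id id

module _ (n : ℕ) where

  idPerm-inv-free : ∀ x → ¬ Inv n (idPerm n) x
  idPerm-inv-free (suc a , suc b) (_ , s≤s a<b , b≤n , b<a)
    rewrite pos-idPerm n b b≤n | pos-idPerm n a (<-trans a<b b≤n) = <-asym a<b b<a

  invCount-idPerm : invCount n (idPerm n) ≡ 0
  invCount-idPerm = cong length (filter-none (inv? n (idPerm n)) {xs = allPairs n} (All.tabulate λ {x} _ → idPerm-inv-free x))

  ValidWord : List ℕ → Set
  ValidWord = All (λ i → 1 ≤ i × i < n)

  data Ascending : List ℕ → List ℕ → Set where
    []   : ∀ {v} → Ascending v []
    step : ∀ {v i is} → 1 ≤ i → i < n → ¬ Inv n v (adjPair v i) →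
           Ascending (swapAt i v) is → Ascending v (i ∷ is)

  invCount-swapAt-≤ : ∀ {v} i → IsPerm n v → 1 ≤ i → i < n → invCount n (swapAt i v) ≤ suc (invCount n v)
  invCount-swapAt-≤ {v} i v↭ 1≤i i<n =
    length-filter-⊆-suc (inv? n (swapAt i v)) (inv? n v) (allPairs n) (adjPair v i) (allPairs-unique n) new
    where
    new : ∀ x → Inv n (swapAt i v) x → Inv n v x ⊎ x ≡ adjPair v i
    new x inv with x ≟² adjPair v i
    ... | yes x≡ = inj₂ x≡
    ... | no x≢  = inj₁ (Adjacent.inv-swapAt⁻ n v↭ 1≤i i<n x≢ inv)

  invCount-swapAt-inv : ∀ {v} i → IsPerm n v → 1 ≤ i → i < n → Inv n v (adjPair v i) →
                        invCount n (swapAt i v) ≤ invCount n v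
  invCount-swapAt-inv {v} i v↭ 1≤i i<n adj-inv =
    length-filter-⊆ (inv? n (swapAt i v)) (inv? n v) (allPairs n) old
    where
    old : ∀ x → x ∈ allPairs n → Inv n (swapAt i v) x → Inv n v x
    old x _ inv with x ≟² adjPair v i
    ... | yes refl = adj-inv
    ... | no x≢    = Adjacent.inv-swapAt⁻ n v↭ 1≤i i<n x≢ inv

  invCount-act-≤ : ∀ {v} is → IsPerm n v → ValidWord is → invCount n (act v is) ≤ invCount n v + length is
  invCount-act-≤ {v} []       _  _                      = m≤m+n _ 0
  invCount-act-≤ {v} (i ∷ is) v↭ ((1≤i , i<n) ∷ valid) = begin
    invCount n (act (swapAt i v) is)     ≤⟨ invCount-act-≤ is (swapAt-isPerm n i v↭) valid ⟩
    invCount n (swapAt i v) + length is  ≤⟨ +-monoˡ-≤ (length is) (invCount-swapAt-≤ i v↭ 1≤i i<n) ⟩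
    suc (invCount n v) + length is       ≡⟨ +-suc _ _ ⟨
    invCount n v + suc (length is)       ∎
    where open ≤-Reasoning

  ascending : ∀ {v} is → IsPerm n v → ValidWord is → invCount n (act v is) ≡ invCount n v + length is →
              Ascending v is
  ascending []       _  _                      _     = []
  ascending {v} (i ∷ is) v↭ ((1≤i , i<n) ∷ valid) total =
    step 1≤i i<n new (ascending is (swapAt-isPerm n i v↭) valid (≤-antisym upper lower))
    where
    open ≤-Reasoning
    upper : invCount n (act (swapAt i v) is) ≤ invCount n (swapAt i v) + length is
    upper = invCount-act-≤ is (swapAt-isPerm n i v↭) valid
    lower : invCount n (swapAt i v) + length is ≤ invCount n (act (swapAt i v) is)
    lower = begin
      invCount n (swapAt i v) + length is  ≤⟨ +-monoˡ-≤ (length is) (invCount-swapAt-≤ i v↭ 1≤i i<n) ⟩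
      suc (invCount n v) + length is       ≡⟨ +-suc _ _ ⟨
      invCount n v + suc (length is)       ≡⟨ total ⟨
      invCount n (act (swapAt i v) is)     ∎
    new : ¬ Inv n v (adjPair v i)
    new adj-inv = <-irrefl refl (begin-strict
      invCount n v + length is             <⟨ +-monoʳ-< (invCount n v) (n<1+n _) ⟩
      invCount n v + suc (length is)       ≡⟨ total ⟨
      invCount n (act (swapAt i v) is)     ≤⟨ upper ⟩
      invCount n (swapAt i v) + length is  ≤⟨ +-monoˡ-≤ (length is) (invCount-swapAt-inv i v↭ 1≤i i<n adj-inv) ⟩
      invCount n v + length is             ∎)

  Reduced : List ℕ → Set
  Reduced is = ValidWord is × invCount n (act (idPerm n) is) ≡ length is

  Reduced⇒Ascending : ∀ {is} → Reduced is → Ascending (idPerm n) is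
  Reduced⇒Ascending {is} (valid , count) =
    ascending is ↭-refl valid (trans count (cong (_+ length is) (sym invCount-idPerm)))

nth : ∀ {X : Set} → List X → ℕ → Maybe X
nth []       _       = nothing
nth (x ∷ xs) zero    = just x
nth (x ∷ xs) (suc p) = nth xs p

nth-length : ∀ {X : Set} (xs : List X) p {x} → nth xs p ≡ just x → p < length xs
nth-length (_ ∷ xs) zero    _ = s≤s z≤n
nth-length (_ ∷ xs) (suc p) e = s≤s (nth-length xs p e)

nth-<length : ∀ {X : Set} (xs : List X) p → p < length xs → ∃[ x ] (nth xs p ≡ just x)
nth-<length (x ∷ xs) zero    _        = x , refl
nth-<length (x ∷ xs) (suc p) (s≤s p<) = nth-<length xs p p<

nth⇒∈ : ∀ {X : Set} (xs : List X) p {x} → nth xs p ≡ just x → x ∈ xs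
nth⇒∈ (y ∷ xs) zero    e = here (sym (just-injective e))
nth⇒∈ (y ∷ xs) (suc p) e = there (nth⇒∈ xs p e)

∈⇒nth : ∀ {X : Set} {x : X} xs → x ∈ xs → ∃[ p ] (nth xs p ≡ just x)
∈⇒nth (y ∷ xs) (here refl) = 0 , refl
∈⇒nth (y ∷ xs) (there x∈)  = Data.Product.map suc id (∈⇒nth xs x∈)

nth-++ˡ : ∀ {X : Set} (xs ys : List X) p → p < length xs → nth (xs ++ ys) p ≡ nth xs p
nth-++ˡ (x ∷ xs) ys zero    _         = refl
nth-++ˡ (x ∷ xs) ys (suc p) (s≤s p<) = nth-++ˡ xs ys p p<

letter-nth : ∀ is p {i} → nth is p ≡ just i → letter is (suc p) ≡ i
letter-nth (_ ∷ is)     zero    e = just-injective e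
letter-nth (_ ∷ j ∷ is) (suc p) e = letter-nth (j ∷ is) p e

Step : Set
Step = ℕ × (ℕ × ℕ)

steps : List ℕ → List ℕ → List Step
steps v []       = []
steps v (i ∷ is) = (i , adjPair v i) ∷ steps (swapAt i v) is

-- For a reduced word 𝐢, the j-th entry of heapSteps n 𝐢 is (i_j , x_j), with x_j as in the heap poset.
heapSteps : ℕ → List ℕ → List Step
heapSteps n = steps (idPerm n)

LabelAt : List Step → ℕ → ℕ × ℕ → Set
LabelAt E p x = ∃[ i ] (nth E p ≡ just (i , x))

LabelBefore : List Step → ℕ → ℕ × ℕ → Set
LabelBefore E m x = ∃[ p ] (p < m × LabelAt E p x)

length-steps : ∀ v is → length (steps v is) ≡ length is
length-steps v []       = refl
length-steps v (i ∷ is) = cong suc (length-steps (swapAt i v) is)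

nth-steps : ∀ v is p {i x} → nth (steps v is) p ≡ just (i , x) → nth is p ≡ just i
nth-steps v (j ∷ is) zero    e with just-injective e
... | refl = refl
nth-steps v (j ∷ is) (suc p) e = nth-steps (swapAt j v) is p e

nth-steps-adjPair : ∀ v is p {i x} → nth (steps v is) p ≡ just (i , x) → x ≡ adjPair (act v (take p is)) i
nth-steps-adjPair v (j ∷ is) zero    e with just-injective e
... | refl = refl
nth-steps-adjPair v (j ∷ is) (suc p) e = nth-steps-adjPair (swapAt j v) is p e

nth-steps-just : ∀ v is p {i} → nth is p ≡ just i → nth (steps v is) p ≡ just (i , adjPair (act v (take p is)) i)
nth-steps-just v (j ∷ is) zero    e with just-injective e
... | refl = refl
nth-steps-just v (j ∷ is) (suc p) e = nth-steps-just (swapAt j v) is p e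

act-take-suc : ∀ v is p {i} → nth is p ≡ just i → act v (take (suc p) is) ≡ swapAt i (act v (take p is))
act-take-suc v (j ∷ is) zero    e with just-injective e
... | refl = refl
act-take-suc v (j ∷ is) (suc p) e = act-take-suc (swapAt j v) is p e

LabelAt⇒< : ∀ v is {p x} → LabelAt (steps v is) p x → p < length is
LabelAt⇒< v is {p} (_ , e) = subst (p <_) (length-steps v is) (nth-length (steps v is) p e)

module _ (n : ℕ) where

  inv-act-take⁻ : ∀ {v} is → IsPerm n v → Ascending n v is → ∀ m x →
                  Inv n (act v (take m is)) x → Inv n v x ⊎ LabelBefore (steps v is) m x
  inv-act-take⁻ is       _  _                        zero    x inv = inj₁ inv
  inv-act-take⁻ []       _  _                        (suc m) x inv = inj₁ inv
  inv-act-take⁻ {v} (i ∷ is) v↭ (step 1≤i i<n _ asc) (suc m) x inv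
    with inv-act-take⁻ is (swapAt-isPerm n i v↭) asc m x inv
  ... | inj₂ (p , p<m , lab) = inj₂ (suc p , s≤s p<m , lab)
  ... | inj₁ inv′ with x ≟² adjPair v i
  ...   | yes refl = inj₂ (0 , s≤s z≤n , i , refl)
  ...   | no x≢    = inj₁ (Adjacent.inv-swapAt⁻ n v↭ 1≤i i<n x≢ inv′)

  inv-act-take⁺ : ∀ {v} is → IsPerm n v → Ascending n v is → ∀ m x →
                  Inv n v x ⊎ LabelBefore (steps v is) m x → Inv n (act v (take m is)) x
  inv-act-take⁺ is _ _ zero x (inj₁ inv) = inv
  inv-act-take⁺ [] _ _ (suc m) x (inj₁ inv) = inv
  inv-act-take⁺ {v} (i ∷ is) v↭ (step 1≤i i<n new asc) (suc m) x (inj₁ inv) with x ≟² adjPair v i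
  ... | yes refl = ⊥-elim (new inv)
  ... | no x≢    =
    inv-act-take⁺ is (swapAt-isPerm n i v↭) asc m x (inj₁ (Adjacent.inv-swapAt⁺ n v↭ 1≤i i<n x≢ inv))
  inv-act-take⁺ (i ∷ is) v↭ (step 1≤i i<n new asc) (suc m) x (inj₂ (zero , _ , _ , e)) with just-injective e
  ... | refl = inv-act-take⁺ is (swapAt-isPerm n i v↭) asc m x (inj₁ (Adjacent.inv-swapAt-adjPair n v↭ 1≤i i<n new))
  inv-act-take⁺ (i ∷ is) v↭ (step _ _ _ asc) (suc m) x (inj₂ (suc p , s≤s p<m , lab)) =
    inv-act-take⁺ is (swapAt-isPerm n i v↭) asc m x (inj₂ (p , p<m , lab))
  inv-act-take⁺ _ _ _ zero x (inj₂ (_ , () , _))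
  inv-act-take⁺ [] _ _ (suc m) x (inj₂ (_ , _ , _ , ()))

  label-not-inv : ∀ {v} is → IsPerm n v → Ascending n v is → ∀ {p x} → LabelAt (steps v is) p x → ¬ Inv n v x
  label-not-inv (i ∷ is) v↭ (step _ _ new _) {zero} (_ , e) with just-injective e
  ... | refl = new
  label-not-inv {v} (i ∷ is) v↭ (step 1≤i i<n new asc) {suc p} {x} lab inv with x ≟² adjPair v i
  ... | yes refl = new inv
  ... | no x≢    = label-not-inv is (swapAt-isPerm n i v↭) asc lab (Adjacent.inv-swapAt⁺ n v↭ 1≤i i<n x≢ inv)

  label-unique : ∀ {v} is → IsPerm n v → Ascending n v is → ∀ {p q x} →
                 LabelAt (steps v is) p x → LabelAt (steps v is) q x → p ≡ q
  label-unique (i ∷ is) _ _ {zero} {zero} _ _ = refl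
  label-unique (i ∷ is) v↭ (step 1≤i i<n new asc) {zero} {suc q} (_ , e) lab with just-injective e
  ... | refl = ⊥-elim (label-not-inv is (swapAt-isPerm n i v↭) asc lab (Adjacent.inv-swapAt-adjPair n v↭ 1≤i i<n new))
  label-unique (i ∷ is) v↭ (step 1≤i i<n new asc) {suc p} {zero} lab (_ , e) with just-injective e
  ... | refl = ⊥-elim (label-not-inv is (swapAt-isPerm n i v↭) asc lab (Adjacent.inv-swapAt-adjPair n v↭ 1≤i i<n new))
  label-unique (i ∷ is) v↭ (step _ _ _ asc) {suc p} {suc q} lab lab′ =
    cong suc (label-unique is (swapAt-isPerm n i v↭) asc lab lab′)

  inv-prefix⁻ : ∀ {is} → Ascending n (idPerm n) is → ∀ m x →
                Inv n (act (idPerm n) (take m is)) x → LabelBefore (heapSteps n is) m x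
  inv-prefix⁻ {is} asc m x inv with inv-act-take⁻ is ↭-refl asc m x inv
  ... | inj₁ inv₀ = ⊥-elim (idPerm-inv-free n x inv₀)
  ... | inj₂ lab  = lab

  inv-prefix⁺ : ∀ {is} → Ascending n (idPerm n) is → ∀ m x →
                LabelBefore (heapSteps n is) m x → Inv n (act (idPerm n) (take m is)) x
  inv-prefix⁺ {is} asc m x lab = inv-act-take⁺ is ↭-refl asc m x (inj₂ lab)

  heapLabel⇒LabelAt : ∀ {is} → Ascending n (idPerm n) is → ∀ j x →
                      HeapLabel n is j x → LabelAt (heapSteps n is) (j ∸ 1) x
  heapLabel⇒LabelAt asc (suc j) x (_ , _ , new , ¬old) with inv-prefix⁻ asc (suc j) x new
  ... | p , s≤s p≤j , lab with m≤n⇒m<n∨m≡n p≤j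
  ...   | inj₂ refl = lab
  ...   | inj₁ p<j  = ⊥-elim (¬old (inv-prefix⁺ asc j x (p , p<j , lab)))

  LabelAt⇒heapLabel : ∀ {is} → Ascending n (idPerm n) is → ∀ p x →
                      LabelAt (heapSteps n is) p x → HeapLabel n is (suc p) x
  LabelAt⇒heapLabel {is} asc p x lab =
    s≤s z≤n , LabelAt⇒< (idPerm n) is lab , inv-prefix⁺ asc (suc p) x (p , ≤-refl , lab) , not-yet
    where
    not-yet : ¬ Inv n (act (idPerm n) (take p is)) x
    not-yet inv with inv-prefix⁻ asc p x inv
    ... | q , q<p , lab′ = <-irrefl (label-unique is ↭-refl asc lab′ lab) q<p

  Linked : List ℕ → ℕ → ℕ → Set
  Linked is p q = p < q × ∣ letter is (suc p) - letter is (suc q) ∣ ≤ 1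

  heapGen⇒Linked : ∀ {is} → Ascending n (idPerm n) is → ∀ x y → HeapGen n is x y →
                   ∃[ p ] ∃[ q ] (Linked is p q × LabelAt (heapSteps n is) p x × LabelAt (heapSteps n is) q y)
  heapGen⇒Linked asc x y (suc j , suc k , s≤s j<k , close , x-lab , y-lab) =
    j , k , (j<k , close) , heapLabel⇒LabelAt asc (suc j) x x-lab , heapLabel⇒LabelAt asc (suc k) y y-lab

  Linked⇒heapGen : ∀ {is} → Ascending n (idPerm n) is → ∀ {p q x y} → Linked is p q →
                   LabelAt (heapSteps n is) p x → LabelAt (heapSteps n is) q y → HeapGen n is x y
  Linked⇒heapGen asc {p} {q} {x} {y} (p<q , close) x-lab y-lab =
    suc p , suc q , s≤s p<q , close , LabelAt⇒heapLabel asc p x x-lab , LabelAt⇒heapLabel asc q y y-lab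

-- Commutation moves

far-apart : ∀ i j → 2 ≤ ∣ i - j ∣ → 2 + i ≤ j ⊎ 2 + j ≤ i
far-apart zero          (suc (suc j)) _ = inj₁ (s≤s (s≤s z≤n))
far-apart (suc (suc i)) zero          _ = inj₂ (s≤s (s≤s z≤n))
far-apart (suc i)       (suc j)       d = Data.Sum.map s≤s s≤s (far-apart i j d)
far-apart zero          zero          ()
far-apart zero          (suc zero)    (s≤s ())
far-apart (suc zero)    zero          (s≤s ())

letter-cons : ∀ x r k → letter (x ∷ r) (suc (suc k)) ≡ letter r (suc k)
letter-cons x []      k = refl
letter-cons x (_ ∷ r) k = refl

letter-swapAt : ∀ i u k → k < i ⊎ 2 + i ≤ k → letter (swapAt i u) k ≡ letter u k
letter-swapAt zero          u           k                   _ = refl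
letter-swapAt (suc zero)    []          k                   _ = refl
letter-swapAt (suc (suc i)) []          k                   _ = refl
letter-swapAt (suc zero)    (x ∷ [])    k                   _ = refl
letter-swapAt (suc zero)    (x ∷ y ∷ r) zero                _ = refl
letter-swapAt (suc zero)    (x ∷ y ∷ r) (suc (suc (suc k))) _ = refl
letter-swapAt (suc (suc i)) (x ∷ r)     zero                _ = refl
letter-swapAt (suc (suc i)) (x ∷ r)     (suc zero)          _ = refl
letter-swapAt (suc (suc i)) (x ∷ r)     (suc (suc k))       outside =
  trans (letter-cons x (swapAt (suc i) r) k)
        (trans (letter-swapAt (suc i) r (suc k) (Data.Sum.map ≤-pred ≤-pred outside)) (sym (letter-cons x r k)))
letter-swapAt (suc zero)    (x ∷ y ∷ r) (suc zero)          (inj₁ (s≤s ()))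
letter-swapAt (suc zero)    (x ∷ y ∷ r) (suc zero)          (inj₂ (s≤s ()))
letter-swapAt (suc zero)    (x ∷ y ∷ r) (suc (suc zero))    (inj₁ (s≤s ()))
letter-swapAt (suc zero)    (x ∷ y ∷ r) (suc (suc zero))    (inj₂ (s≤s (s≤s ())))

adjPair-swapAt : ∀ i j u → 2 ≤ ∣ i - j ∣ → adjPair (swapAt i u) j ≡ adjPair u j
adjPair-swapAt i j u d =
  cong₂ (λ a b → a ⊓ b , a ⊔ b) (letter-swapAt i u j (outside d)) (letter-swapAt i u (suc j) (outside-suc d))
  where
  outside : 2 ≤ ∣ i - j ∣ → j < i ⊎ 2 + i ≤ j
  outside d with far-apart i j d
  ... | inj₁ i+2≤j = inj₂ i+2≤j
  ... | inj₂ j+2≤i = inj₁ (≤-trans (n≤1+n _) j+2≤i)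
  outside-suc : 2 ≤ ∣ i - j ∣ → suc j < i ⊎ 2 + i ≤ suc j
  outside-suc d with far-apart i j d
  ... | inj₁ i+2≤j = inj₂ (m≤n⇒m≤1+n i+2≤j)
  ... | inj₂ j+2≤i = inj₁ j+2≤i

swapAt-comm-< : ∀ i j u → 2 + i ≤ j → swapAt i (swapAt j u) ≡ swapAt j (swapAt i u)
swapAt-comm-< zero          j                         u           _        = refl
swapAt-comm-< (suc zero)    (suc (suc (suc j)))       []          _        = refl
swapAt-comm-< (suc zero)    (suc (suc (suc j)))       (x ∷ [])    _        = refl
swapAt-comm-< (suc zero)    (suc (suc (suc j)))       (x ∷ y ∷ r) _        = refl
swapAt-comm-< (suc (suc i)) (suc (suc (suc (suc j)))) []          _        = refl
swapAt-comm-< (suc (suc i)) (suc (suc (suc (suc j)))) (x ∷ r)     (s≤s le) =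
  cong (x ∷_) (swapAt-comm-< (suc i) (suc (suc (suc j))) r le)
swapAt-comm-< (suc zero)    (suc zero)                u           (s≤s ())
swapAt-comm-< (suc zero)    (suc (suc zero))          u           (s≤s (s≤s ()))
swapAt-comm-< (suc (suc i)) (suc zero)                u           (s≤s ())
swapAt-comm-< (suc (suc i)) (suc (suc zero))          u           (s≤s (s≤s ()))
swapAt-comm-< (suc (suc i)) (suc (suc (suc zero)))    u           (s≤s (s≤s (s≤s ())))

swapAt-comm : ∀ i j u → 2 ≤ ∣ i - j ∣ → swapAt i (swapAt j u) ≡ swapAt j (swapAt i u)
swapAt-comm i j u d with far-apart i j d
... | inj₁ i+2≤j = swapAt-comm-< i j u i+2≤j
... | inj₂ j+2≤i = sym (swapAt-comm-< j i u j+2≤i)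

steps-++ : ∀ v xs ys → steps v (xs ++ ys) ≡ steps v xs ++ steps (act v xs) ys
steps-++ v []       ys = refl
steps-++ v (x ∷ xs) ys = cong ((x , adjPair v x) ∷_) (steps-++ (swapAt x v) xs ys)

data StepSwap : List Step → List Step → Set where
  swap-steps : ∀ A B s t → 2 ≤ ∣ proj₁ s - proj₁ t ∣ → StepSwap (A ++ s ∷ t ∷ B) (A ++ t ∷ s ∷ B)

steps-swapped : ∀ v xs i j ys → 2 ≤ ∣ i - j ∣ →
  steps v (xs ++ j ∷ i ∷ ys)
  ≡ steps v xs ++ (j , adjPair (swapAt i (act v xs)) j) ∷ (i , adjPair (act v xs) i)
                 ∷ steps (swapAt j (swapAt i (act v xs))) ys
steps-swapped v xs i j ys d = trans (steps-++ v xs (j ∷ i ∷ ys)) (cong (steps v xs ++_) middle)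
  where
  u = act v xs
  middle : (j , adjPair u j) ∷ (i , adjPair (swapAt j u) i) ∷ steps (swapAt i (swapAt j u)) ys
         ≡ (j , adjPair (swapAt i u) j) ∷ (i , adjPair u i) ∷ steps (swapAt j (swapAt i u)) ys
  middle = cong₂ _∷_ (cong (j ,_) (sym (adjPair-swapAt i j u d)))
                     (cong₂ _∷_ (cong (i ,_) (adjPair-swapAt j i u (subst (2 ≤_) (∣-∣-comm i j) d)))
                                (cong (λ u′ → steps u′ ys) (swapAt-comm i j u d)))

commStep-steps : ∀ v {is js} → CommStep is js → StepSwap (steps v is) (steps v js)
commStep-steps v (comm xs ys i j d) =
  subst₂ StepSwap (sym (steps-++ v xs (i ∷ j ∷ ys))) (sym (steps-swapped v xs i j ys d)) (swap-steps _ _ _ _ d)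

commStep-act : ∀ v {is js} → CommStep is js → act v is ≡ act v js
commStep-act v (comm xs ys i j d) = begin
  act v (xs ++ i ∷ j ∷ ys)                   ≡⟨ foldl-++ _ v xs (i ∷ j ∷ ys) ⟩
  act (swapAt j (swapAt i (act v xs))) ys    ≡⟨ cong (λ u → act u ys) (swapAt-comm i j (act v xs) d) ⟨
  act (swapAt i (swapAt j (act v xs))) ys    ≡⟨ foldl-++ _ v xs (j ∷ i ∷ ys) ⟨
  act v (xs ++ j ∷ i ∷ ys)                   ∎
  where open ≡-Reasoning

commStep-length : ∀ {is js} → CommStep is js → length is ≡ length js
commStep-length (comm xs ys i j _) = trans (length-++ xs) (sym (length-++ xs))

commStep-All : ∀ {P : ℕ → Set} {is js} → CommStep is js → All P is → All P js
commStep-All (comm xs ys i j _) Pis with ++⁻ xs Pis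
... | Pxs , Pi ∷ Pj ∷ Pys = ++⁺ Pxs (Pj ∷ Pi ∷ Pys)

module _ (n : ℕ) where

  commStep-reduced : ∀ {is js} → CommStep is js → Reduced n is → Reduced n js
  commStep-reduced c (valid , count) =
    commStep-All c valid , trans (cong (invCount n) (sym (commStep-act (idPerm n) c))) (trans count (commStep-length c))

  inClass-reduced : ∀ {is js} → InClass is js → Reduced n is → Reduced n js
  inClass-reduced ε        red = red
  inClass-reduced (c ◅ cs) red = inClass-reduced cs (commStep-reduced c red)

inClass-steps : ∀ v {is js} → InClass is js → Star StepSwap (steps v is) (steps v js)
inClass-steps v ε        = ε
inClass-steps v (c ◅ cs) = commStep-steps v c ◅ inClass-steps v cs

Precedes : List Step → Step → Step → Set
Precedes E s t = ∃[ p ] ∃[ q ] (p < q × nth E p ≡ just s × nth E q ≡ just t)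

nth-swapIndex : ∀ {X : Set} (A : List X) s t B p →
                nth (A ++ t ∷ s ∷ B) (swapIndex (suc (length A)) p) ≡ nth (A ++ s ∷ t ∷ B) p
nth-swapIndex []      s t B zero          = refl
nth-swapIndex []      s t B (suc zero)    = refl
nth-swapIndex []      s t B (suc (suc p)) = refl
nth-swapIndex (a ∷ A) s t B zero          = refl
nth-swapIndex (a ∷ A) s t B (suc p)       = nth-swapIndex A s t B p

nth-middle : ∀ {X : Set} (A : List X) s t B →
             nth (A ++ s ∷ t ∷ B) (length A) ≡ just s × nth (A ++ s ∷ t ∷ B) (suc (length A)) ≡ just t
nth-middle []      s t B = refl , refl
nth-middle (a ∷ A) s t B = nth-middle A s t B

precedes-swap : ∀ {E E′ s t} → StepSwap E E′ → ∣ proj₁ s - proj₁ t ∣ ≤ 1 →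
                Precedes E s t → Precedes E′ s t
precedes-swap (swap-steps A B s′ t′ far) close (p , q , p<q , s-at , t-at) =
  swapIndex k p , swapIndex k q , swapIndex-mono-< k p q p<q not-swapped ,
  trans (nth-swapIndex A s′ t′ B p) s-at , trans (nth-swapIndex A s′ t′ B q) t-at
  where
  k = suc (length A)
  not-swapped : p ≡ length A → q ≡ suc (length A) → ⊥
  not-swapped refl refl with just-injective (trans (sym s-at) (proj₁ (nth-middle A s′ t′ B)))
                            | just-injective (trans (sym t-at) (proj₂ (nth-middle A s′ t′ B)))
  ... | refl | refl = <⇒≱ far close

precedes-swaps : ∀ {E E′ s t} → Star StepSwap E E′ → ∣ proj₁ s - proj₁ t ∣ ≤ 1 →
                 Precedes E s t → Precedes E′ s t
precedes-swaps ε        _     prec = prec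
precedes-swaps (σ ◅ σs) close prec = precedes-swaps σs close (precedes-swap σ close prec)

letter-label : ∀ v is p {i x} → nth (steps v is) p ≡ just (i , x) → letter is (suc p) ≡ i
letter-label v is p e = letter-nth is p (nth-steps v is p e)

label-distance : ∀ v is {p q i j x y} → nth (steps v is) p ≡ just (i , x) → nth (steps v is) q ≡ just (j , y) →
                 ∣ letter is (suc p) - letter is (suc q) ∣ ≡ ∣ i - j ∣
label-distance v is x-at y-at = cong₂ ∣_-_∣ (letter-label v is _ x-at) (letter-label v is _ y-at)

module _ (n : ℕ) where

  -- Commutation moves never exchange close letters, so x stays before y in every word of the class.
  linked-inv-prefix : ∀ {is js} → Reduced n is → InClass is js → ∀ {p q x y} → Linked n is p q →
    LabelAt (heapSteps n is) p x → LabelAt (heapSteps n is) q y →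
    ∀ m → Inv n (act (idPerm n) (take m js)) y → Inv n (act (idPerm n) (take m js)) x
  linked-inv-prefix {is} {js} red cls {p} {q} {x} {y} (p<q , close) (i , x-at) (j , y-at) m y-inv =
    finish (inv-prefix⁻ n asc m y y-inv) (precedes-swaps (inClass-steps (idPerm n) cls) close′ (p , q , p<q , x-at , y-at))
    where
    asc = Reduced⇒Ascending n (inClass-reduced n cls red)
    close′ : ∣ i - j ∣ ≤ 1
    close′ = subst (_≤ 1) (label-distance _ is x-at y-at) close
    finish : LabelBefore (heapSteps n js) m y → Precedes (heapSteps n js) (i , x) (j , y) →
             Inv n (act (idPerm n) (take m js)) x
    finish (q′ , q′<m , y-lab) (p′ , q″ , p′<q″ , x-at′ , y-at′) =
      inv-prefix⁺ n asc m x
        (p′ , <-trans p′<q″ (subst (_< m) (label-unique n js ↭-refl asc y-lab (j , y-at′)) q′<m) , i , x-at′)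

-- The tally is strictly decreasing on the heap

module _ {X : Set} (ρ : X → ℕ) {P Q : X → Set} (P? : Decidable P) (Q? : Decidable Q) where

  sum-filter-⊆ : ∀ xs → (∀ x → x ∈ xs → P x → Q x) → sum (map ρ (filter P? xs)) ≤ sum (map ρ (filter Q? xs))
  sum-filter-⊆ []       _   = z≤n
  sum-filter-⊆ (x ∷ xs) P⊆Q with P? x | Q? x
  ... | yes _ | yes _ = +-monoʳ-≤ (ρ x) (sum-filter-⊆ xs (λ y → P⊆Q y ∘ there))
  ... | yes p | no ¬q = ⊥-elim (¬q (P⊆Q x (here refl) p))
  ... | no _  | yes _ = ≤-trans (sum-filter-⊆ xs (λ y → P⊆Q y ∘ there)) (m≤n+m _ (ρ x))
  ... | no _  | no _  = sum-filter-⊆ xs (λ y → P⊆Q y ∘ there)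

  sum-filter-⊂ : ∀ xs → (∀ x → x ∈ xs → P x → Q x) →
                 ∀ {x₀} → x₀ ∈ xs → Q x₀ → ¬ P x₀ → 0 < ρ x₀ →
                 sum (map ρ (filter P? xs)) < sum (map ρ (filter Q? xs))
  sum-filter-⊂ (x ∷ xs) P⊆Q (here refl) q ¬p ρ>0 with P? x | Q? x
  ... | yes p | _     = ⊥-elim (¬p p)
  ... | no _  | no ¬q = ⊥-elim (¬q q)
  ... | no _  | yes _ = <-≤-trans (m<n+m _ ρ>0) (+-monoʳ-≤ (ρ x) (sum-filter-⊆ xs (λ y → P⊆Q y ∘ there)))
  sum-filter-⊂ (x ∷ xs) P⊆Q (there x₀∈) q ¬p ρ>0 with P? x | Q? x
  ... | yes _ | yes _ = +-monoʳ-< (ρ x) (sum-filter-⊂ xs (λ y → P⊆Q y ∘ there) x₀∈ q ¬p ρ>0)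
  ... | yes p | no ¬q = ⊥-elim (¬q (P⊆Q x (here refl) p))
  ... | no _  | yes _ = <-≤-trans (sum-filter-⊂ xs (λ y → P⊆Q y ∘ there) x₀∈ q ¬p ρ>0) (m≤n+m _ (ρ x))
  ... | no _  | no _  = sum-filter-⊂ xs (λ y → P⊆Q y ∘ there) x₀∈ q ¬p ρ>0

module TallyDecreasing
  (n : ℕ) {is : List ℕ} (red : Reduced n is) (ρ : List ℕ → ℕ) (P : List (List ℕ))
  (P⊆Pre : ∀ v → v ∈ P → InPre n is v) (Pre⊆P : ∀ v → InPre n is v → v ∈ P)
  (ρ-pos : ∀ v → IsPerm n v → InPre n is v → 0 < ρ v)
  where

  private
    asc = Reduced⇒Ascending n red

  -- Prefixes inverting y invert x, and the prefix of is ending with x inverts x but not y.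
  tally-linked : ∀ {p q x y} → Linked n is p q → LabelAt (heapSteps n is) p x → LabelAt (heapSteps n is) q y →
                 tally n ρ P y < tally n ρ P x
  tally-linked {p} {q} {a , b} {c , d} linked x-lab y-lab =
    sum-filter-⊂ ρ (λ v → invPair? n v c d) (λ v → invPair? n v a b) P below
      (Pre⊆P v₀ v₀-pre) v₀-x ¬v₀-y (ρ-pos v₀ (act-isPerm n (take (suc p) is) ↭-refl) v₀-pre)
    where
    below : ∀ v → v ∈ P → InvPair n v c d → InvPair n v a b
    below v v∈ with P⊆Pre v v∈
    ... | js , m , cls , _ , refl = linked-inv-prefix n red cls linked x-lab y-lab m
    v₀ = act (idPerm n) (take (suc p) is)
    v₀-pre : InPre n is v₀
    v₀-pre = is , suc p , ε , LabelAt⇒< (idPerm n) is x-lab , refl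
    v₀-x : InvPair n v₀ a b
    v₀-x = inv-prefix⁺ n asc (suc p) (a , b) (p , ≤-refl , x-lab)
    ¬v₀-y : ¬ InvPair n v₀ c d
    ¬v₀-y inv with inv-prefix⁻ n asc (suc p) (c , d) inv
    ... | q′ , s≤s q′≤p , y-lab′ =
      <⇒≱ (proj₁ linked) (subst (_≤ p) (label-unique n is ↭-refl asc y-lab′ y-lab) q′≤p)

  tally-heapGen : ∀ {x y} → HeapGen n is x y → tally n ρ P y < tally n ρ P x
  tally-heapGen {x} {y} gen with heapGen⇒Linked n asc x y gen
  ... | _ , _ , linked , x-lab , y-lab = tally-linked linked x-lab y-lab

  tally-heapLt : ∀ {x y} → HeapLt n is x y → tally n ρ P y < tally n ρ P x
  tally-heapLt [ gen ]    = tally-heapGen gen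
  tally-heapLt (gen ∷ lt) = <-trans (tally-heapLt lt) (tally-heapGen gen)

-- Down-closed sets of labels are inversion sets of prefixes

steps-letters : ∀ v is → map proj₁ (steps v is) ≡ is
steps-letters v []       = refl
steps-letters v (i ∷ is) = cong (i ∷_) (steps-letters (swapAt i v) is)

++-cancel-length : ∀ {X : Set} (xs ys us vs : List X) → length xs ≡ length ys →
                   xs ++ us ≡ ys ++ vs → xs ≡ ys × us ≡ vs
++-cancel-length []       []       us vs _   eq = refl , eq
++-cancel-length (x ∷ xs) (y ∷ ys) us vs len eq with ∷-injective eq
... | refl , eq′ = Data.Product.map₁ (cong (x ∷_)) (++-cancel-length xs ys us vs (suc-injective len) eq′)

swap-heads : ∀ {X : Set} {s t s′ t′ : X} {B B′ : List X} →
             _≡_ {A = List X} (s ∷ t ∷ B) (s′ ∷ t′ ∷ B′) → _≡_ {A = List X} (t ∷ s ∷ B) (t′ ∷ s′ ∷ B′)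
swap-heads refl = refl

swap⇒commStep : ∀ v {E E′} → StepSwap E E′ → ∀ js → steps v js ≡ E →
                ∃[ js′ ] (CommStep js js′ × steps v js′ ≡ E′)
swap⇒commStep v (swap-steps A B s t d) js eq
  with trans (sym (steps-letters v js)) (trans (cong (map proj₁) eq) (map-++ proj₁ A (s ∷ t ∷ B)))
... | refl = xs ++ proj₁ t ∷ proj₁ s ∷ ys , comm xs ys _ _ d ,
             trans (steps-swapped v xs _ _ ys d) (cong₂ _++_ (proj₁ split) (swap-heads (proj₂ split)))
  where
  xs ys : List ℕ
  xs = map proj₁ A
  ys = map proj₁ B
  split : steps v xs ≡ A × steps (act v xs) (proj₁ s ∷ proj₁ t ∷ ys) ≡ s ∷ t ∷ B
  split = ++-cancel-length (steps v xs) A (steps (act v xs) (proj₁ s ∷ proj₁ t ∷ ys)) (s ∷ t ∷ B)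
                           (trans (length-steps v xs) (length-map proj₁ A))
                           (trans (sym (steps-++ v xs (proj₁ s ∷ proj₁ t ∷ ys))) eq)

swaps⇒inClass : ∀ v {E E′} → Star StepSwap E E′ → ∀ js → steps v js ≡ E →
                ∃[ js′ ] (InClass js js′ × steps v js′ ≡ E′)
swaps⇒inClass v ε        js eq = js , ε , eq
swaps⇒inClass v (σ ◅ σs) js eq with swap⇒commStep v σ js eq
... | js₁ , c , eq₁ with swaps⇒inClass v σs js₁ eq₁
... | js′ , cs , eq′ = js′ , c ◅ cs , eq′

swaps-cons : ∀ s {E E′} → Star StepSwap E E′ → Star StepSwap (s ∷ E) (s ∷ E′)
swaps-cons s = gmap (s ∷_) λ { (swap-steps A B t u d) → swap-steps (s ∷ A) B t u d }

swaps-past : ∀ s F G → All (λ t → 2 ≤ ∣ proj₁ s - proj₁ t ∣) F → Star StepSwap (s ∷ F ++ G) (F ++ s ∷ G)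
swaps-past s []      G []       = ε
swaps-past s (t ∷ F) G (d ∷ ds) = swap-steps [] (F ++ G) s t d ◅ swaps-cons t (swaps-past s F G ds)

module _ {Q : ℕ × ℕ → Set} (Q? : Decidable Q) where

  Q-label? : Decidable {A = Step} (Q ∘ proj₂)
  Q-label? s = Q? (proj₂ s)

  DownClosed : List Step → Set
  DownClosed E = ∀ {p q s t} → p < q → nth E p ≡ just s → nth E q ≡ just t →
                 ∣ proj₁ s - proj₁ t ∣ ≤ 1 → Q (proj₂ t) → Q (proj₂ s)

  -- A step outside Q commutes past every later step in Q: a close letter would put it in Q.
  partition-swaps : ∀ E → DownClosed E → Star StepSwap E (filter Q-label? E ++ filter (¬? ∘ Q-label?) E)
  partition-swaps []      _      = ε
  partition-swaps (s ∷ E) closed with Q? (proj₂ s)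
  ... | yes _ = swaps-cons s (partition-swaps E (closed ∘ s≤s))
  ... | no ¬q = swaps-cons s (partition-swaps E (closed ∘ s≤s))
                ◅◅ swaps-past s (filter Q-label? E) (filter (¬? ∘ Q-label?) E) (All.tabulate far)
    where
    far : ∀ {t : Step} → t ∈ filter Q-label? E → 2 ≤ ∣ proj₁ s - proj₁ t ∣
    far {t} t∈ with ∈-filter⁻ Q-label? {xs = E} t∈
    ... | t∈E , qt with ∈⇒nth E t∈E | ∣ proj₁ s - proj₁ t ∣ ≤? 1
    ...   | q , t-at | yes close = ⊥-elim (¬q (closed (s≤s z≤n) refl t-at close qt))
    ...   | _ , _    | no ¬close = ≰⇒> ¬close

module Downsets (n : ℕ) {is : List ℕ} (red : Reduced n is) where

  private
    asc = Reduced⇒Ascending n red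
    E = heapSteps n is
    take-length : act (idPerm n) (take (length is) is) ≡ act (idPerm n) is
    take-length = cong (act (idPerm n)) (take-all (length is) is ≤-refl)

  inv-word⇒label : ∀ x → Inv n (act (idPerm n) is) x → ∃[ p ] LabelAt E p x
  inv-word⇒label x inv with inv-prefix⁻ n asc (length is) x (subst (λ u → Inv n u x) (sym take-length) inv)
  ... | p , _ , lab = p , lab

  label⇒inv-word : ∀ {p x} → LabelAt E p x → Inv n (act (idPerm n) is) x
  label⇒inv-word {p} {x} lab =
    subst (λ u → Inv n u x) take-length (inv-prefix⁺ n asc (length is) x (p , LabelAt⇒< _ is lab , lab))

  prefix-of-downset : ∀ {Q : ℕ × ℕ → Set} (Q? : Decidable Q) →
    (∀ {p q x y} → Linked n is p q → LabelAt E p x → LabelAt E q y → Q y → Q x) →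
    ∃[ v ] (InPre n is v × ∀ a b → (InvPair n (act (idPerm n) is) a b × Q (a , b)) ⇔ InvPair n v a b)
  prefix-of-downset {Q} Q? closed = prefix (swaps⇒inClass (idPerm n) (partition-swaps Q? E down) is refl)
    where
    F G : List Step
    F = filter (Q-label? Q?) E
    G = filter (¬? ∘ Q-label? Q?) E
    m = length F

    down : DownClosed Q? E
    down {p} {q} p<q s-at t-at close =
      closed (p<q , subst (_≤ 1) (sym (label-distance _ is s-at t-at)) close) (_ , s-at) (_ , t-at)

    prefix : ∃[ js ] (InClass is js × heapSteps n js ≡ F ++ G) →
             ∃[ v ] (InPre n is v × ∀ a b → (InvPair n (act (idPerm n) is) a b × Q (a , b)) ⇔ InvPair n v a b)
    prefix (js , cls , js-steps) =
      act (idPerm n) (take m js) , (js , m , cls , m≤ , refl) , λ a b → mk⇔ (into (a , b)) (outof (a , b))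
      where
      asc′ = Reduced⇒Ascending n (inClass-reduced n cls red)

      m≤ : m ≤ length js
      m≤ = subst (m ≤_) (trans (sym (length-++ F)) (trans (cong length (sym js-steps)) (length-steps _ js)))
                 (m≤m+n m (length G))

      nth-js : ∀ r → r < m → nth (heapSteps n js) r ≡ nth F r
      nth-js r r<m = trans (cong (λ l → nth l r) js-steps) (nth-++ˡ F G r r<m)

      into : ∀ x → Inv n (act (idPerm n) is) x × Q x → Inv n (act (idPerm n) (take m js)) x
      into x (inv , qx) with inv-word⇒label x inv
      ... | p , i , E-at with ∈⇒nth F (∈-filter⁺ (Q-label? Q?) (nth⇒∈ E p E-at) qx)
      ... | r , F-at = inv-prefix⁺ n asc′ m x (r , r<m , i , trans (nth-js r r<m) F-at)
        where r<m = nth-length F r F-at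

      outof : ∀ x → Inv n (act (idPerm n) (take m js)) x → Inv n (act (idPerm n) is) x × Q x
      outof x inv with inv-prefix⁻ n asc′ m x inv
      ... | r , r<m , i , js-at with ∈-filter⁻ (Q-label? Q?) {xs = E} (nth⇒∈ F r (trans (sym (nth-js r r<m)) js-at))
      ... | ∈E , qx = label⇒inv-word (i , proj₂ (∈⇒nth E ∈E)) , qx

-- Labels sharing a letter are comparable in the heap

module SharedLetters (n : ℕ) {is : List ℕ} (red : Reduced n is) where

  open Downsets n red using (inv-word⇒label)

  private
    asc = Reduced⇒Ascending n red
    E = heapSteps n is

    prefixPerm : ℕ → List ℕ
    prefixPerm t = act (idPerm n) (take t is)

    prefixPerm-isPerm : ∀ t → IsPerm n (prefixPerm t)
    prefixPerm-isPerm t = act-isPerm n (take t is) ↭-refl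

    letter-valid : ∀ {t i} → nth is t ≡ just i → 1 ≤ i × i < n
    letter-valid e = All.lookup (proj₁ red) (nth⇒∈ is _ e)

  HeapLe : ℕ × ℕ → ℕ × ℕ → Set
  HeapLe x z = x ≡ z ⊎ HeapLt n is x z

  HeapLe-HeapGen : ∀ {x y z} → HeapLe x z → HeapGen n is z y → HeapLt n is x y
  HeapLe-HeapGen (inj₁ refl) gen = [ gen ]
  HeapLe-HeapGen (inj₂ lt)   gen = lt ∷ʳ gen

  module Track (a : ℕ) (x : ℕ × ℕ) where

    -- Invariant: the last step s < t that moved a has a label z ≥ x, and a still sits where its letter i put it.
    Trail : ℕ → Set
    Trail t = ∃[ s ] ∃[ i ] ∃[ z ] (s < t × nth E s ≡ just (i , z) × HeapLe x z × MovedBy i (pos a (prefixPerm t)))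

    link : ∀ {s i z t j} → s < t → nth E s ≡ just (i , z) → nth is t ≡ just j →
           MovedBy i (pos a (prefixPerm t)) → a occursIn adjPair (prefixPerm t) j →
           HeapGen n is z (adjPair (prefixPerm t) j)
    link {s} {i} {z} {t} {j} s<t z-at j-at moved occ =
      Linked⇒heapGen n asc (s<t , close) (i , z-at) (j , nth-steps-just _ is t j-at)
      where
      i-valid = letter-valid (nth-steps _ is s z-at)
      j-valid = letter-valid j-at
      close : ∣ letter is (suc s) - letter is (suc t) ∣ ≤ 1
      close = subst (_≤ 1) (sym (label-distance _ is z-at (nth-steps-just _ is t j-at)))
                (MovedBy-close (proj₁ i-valid) (proj₁ j-valid) moved
                  (Adjacent.occurs⇒MovedBy n (prefixPerm-isPerm t) (proj₁ j-valid) (proj₂ j-valid) a occ))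

    after-step : ∀ {t j k} → nth is t ≡ just j →
                 MovedBy k (pos a (swapAt j (prefixPerm t))) → MovedBy k (pos a (prefixPerm (suc t)))
    after-step j-at = subst (λ u → MovedBy _ (pos a u)) (sym (act-take-suc (idPerm n) is _ j-at))

    start : ∀ {j i} → nth E j ≡ just (i , x) → a occursIn x → Trail (suc j)
    start {j} {i} x-at occ = j , i , x , ≤-refl , x-at , inj₁ refl ,
      after-step i-at (Adjacent.MovedBy-swapAt n (prefixPerm-isPerm j) 1≤i i<n a
        (Adjacent.occurs⇒MovedBy n (prefixPerm-isPerm j) 1≤i i<n a (subst (a occursIn_) (nth-steps-adjPair _ is j x-at) occ)))
      where
      i-at = nth-steps _ is j x-at
      1≤i = proj₁ (letter-valid i-at)
      i<n = proj₂ (letter-valid i-at)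

    advance : ∀ t → t < length is → Trail t → Trail (suc t)
    advance t t< (s , i , z , s<t , z-at , x≤z , moved) with nth-<length is t t<
    ... | j , j-at with letter-valid j-at | occurs? a (adjPair (prefixPerm t) j)
    ...   | 1≤j , j<n | yes occ =
      t , j , adjPair (prefixPerm t) j , ≤-refl , nth-steps-just _ is t j-at ,
      inj₂ (HeapLe-HeapGen x≤z (link s<t z-at j-at moved occ)) ,
      after-step j-at (Adjacent.MovedBy-swapAt n (prefixPerm-isPerm t) 1≤j j<n a
                        (Adjacent.occurs⇒MovedBy n (prefixPerm-isPerm t) 1≤j j<n a occ))
    ...   | 1≤j , j<n | no ¬occ =
      s , i , z , m≤n⇒m≤1+n s<t , z-at , x≤z ,
      after-step j-at (subst (MovedBy i) (sym (Adjacent.pos-swapAt-unmoved n (prefixPerm-isPerm t) 1≤j j<n a ¬occ)) moved)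

    trail : ∀ {j i} → nth E j ≡ just (i , x) → a occursIn x → ∀ t → suc j ≤ t → t ≤ length is → Trail t
    trail x-at occ (suc t) (s≤s j≤t) t≤ with m≤n⇒m<n∨m≡n j≤t
    ... | inj₂ refl = start x-at occ
    ... | inj₁ j<t  = advance t t≤ (trail x-at occ t j<t (≤-trans (n≤1+n t) t≤))

  sharing-letter⇒heapLt : ∀ {a j k i i′ x y} → j < k → nth E j ≡ just (i , x) → nth E k ≡ just (i′ , y) →
                          a occursIn x → a occursIn y → HeapLt n is x y
  sharing-letter⇒heapLt {a} {j} {k} {i} {i′} {x} {y} j<k x-at y-at x∋a y∋a
    with Track.trail a x x-at x∋a k j<k (<⇒≤ (LabelAt⇒< _ is (i′ , y-at)))
  ... | s , _ , z , s<k , z-at , x≤z , moved =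
    HeapLe-HeapGen x≤z (subst (HeapGen n is z) (sym y≡)
      (Track.link a x s<k z-at (nth-steps _ is k y-at) moved (subst (a occursIn_) y≡ y∋a)))
    where
    y≡ = nth-steps-adjPair _ is k y-at

  level-disjoint : ∀ (f : ℕ × ℕ → ℕ) → (∀ {x y} → HeapLt n is x y → f y < f x) → ∀ r →
                   PairwiseDisjoint (λ x → Inv n (act (idPerm n) is) x × (+ f x ≡ r))
  level-disjoint f decreasing r a b c d (x-inv , x≡r) (y-inv , y≡r) x≢y =
    no-shared (inj₁ refl) ∘ inj₁ , no-shared (inj₁ refl) ∘ inj₂ ,
    no-shared (inj₂ refl) ∘ inj₁ , no-shared (inj₂ refl) ∘ inj₂
    where
    same : f (a , b) ≡ f (c , d)
    same = ℤ.+-injective (trans x≡r (sym y≡r))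
    no-shared : ∀ {z} → z occursIn (a , b) → z occursIn (c , d) → ⊥
    no-shared x∋z y∋z with inv-word⇒label _ x-inv | inv-word⇒label _ y-inv
    ... | p , _ , x-at | q , _ , y-at with <-cmp p q
    ... | tri< p<q _ _  = <-irrefl (sym same) (decreasing (sharing-letter⇒heapLt p<q x-at y-at x∋z y∋z))
    ... | tri> _ _ q<p  = <-irrefl same (decreasing (sharing-letter⇒heapLt q<p y-at x-at y∋z x∋z))
    ... | tri≈ _ refl _ = x≢y (proj₂ (,-injective (just-injective (trans (sym x-at) y-at))))

module _ {_<P_ : ℕ × ℕ → ℕ × ℕ → Set} (f : ℕ × ℕ → ℕ) (decreasing : ∀ {x y} → x <P y → f y < f x) where

  level-antichain : ∀ (G : ℕ × ℕ → Set) r → IsAntichain _<P_ (λ x → G x × (+ f x ≡ r))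
  level-antichain G r x y (_ , fx≡r) (_ , fy≡r) x<y = <-irrefl (ℤ.+-injective (trans fy≡r (sym fx≡r))) (decreasing x<y)

  upper-set-ideal : ∀ n w (U : ℕ → Set) → (∀ {k l} → k ≤ l → U k → U l) →
                    IsOrderIdeal n w _<P_ (λ x → InvPair n w (proj₁ x) (proj₂ x) × U (f x))
  upper-set-ideal n w U up = (λ _ _ → proj₁) , λ x y (_ , Ux) y-inv y<x → y-inv , up (<⇒≤ (decreasing y<x)) Ux

IsReducedWord⇒Reduced : ∀ {n w is} → IsReducedWord n w is → Reduced n is
IsReducedWord⇒Reduced (valid , refl , len) = valid , sym len

proposition2p4 :
    (n : ℕ) (w : List ℕ) → IsPerm n w →
    (is : List ℕ) → IsReducedWord n w is →
    (ρ : List ℕ → ℕ) →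
    (∀ v → IsPerm n v → ((0 < ρ v) ⇔ InPre n is v)) →
    (P : List (List ℕ)) → Unique P → (∀ v → (v ∈ P) ⇔ InPre n is v) →
    (∀ a b c d → HeapLt n is (a , b) (c , d) →
      tally n ρ P (c , d) < tally n ρ P (a , b)) ×
    (∀ (r : ℤ) →
      (IsAntichain (HeapLt n is)
         (λ x → InvPair n w (Σ.proj₁ x) (Σ.proj₂ x) × (+ tally n ρ P x ≡ r)) ×
       PairwiseDisjoint
         (λ x → InvPair n w (Σ.proj₁ x) (Σ.proj₂ x) × (+ tally n ρ P x ≡ r))) ×
      (IsOrderIdeal n w (HeapLt n is)
         (λ x → InvPair n w (Σ.proj₁ x) (Σ.proj₂ x) × (r ≤ℤ + tally n ρ P x)) ×
       ∃[ v ] (InPre n is v ×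
         (∀ a b → (InvPair n w a b × (r ≤ℤ + tally n ρ P (a , b))) ⇔ InvPair n v a b))) ×
      (IsOrderIdeal n w (HeapLt n is)
         (λ x → InvPair n w (Σ.proj₁ x) (Σ.proj₂ x) × (r <ℤ + tally n ρ P x)) ×
       ∃[ u ] (InPre n is u ×
         (∀ a b → (InvPair n w a b × (r <ℤ + tally n ρ P (a , b))) ⇔ InvPair n u a b))))
proposition2p4 n _ _ is red-word@(_ , refl , _) ρ ρ-supp P _ P-pre =
  (λ _ _ _ _ → tally-heapLt) , λ r →
    (level-antichain Σρ tally-heapLt _ r , level-disjoint Σρ tally-heapLt r) ,
    upper-set (r ℤ.≤?_) (λ k≤l r≤k → ℤ.≤-trans r≤k (+≤+ k≤l)) ,
    upper-set (r ℤ.<?_) (λ k≤l r<k → ℤ.<-≤-trans r<k (+≤+ k≤l))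
  where
  red = IsReducedWord⇒Reduced red-word
  open TallyDecreasing n red ρ P (Equivalence.to ∘ P-pre) (Equivalence.from ∘ P-pre)
                                 (λ v v↭ → Equivalence.from (ρ-supp v v↭))
  open Downsets n red
  open SharedLetters n red

  w = act (idPerm n) is

  Σρ : ℕ × ℕ → ℕ
  Σρ = tally n ρ P

  upper-set : ∀ {U : ℤ → Set} → Decidable U → (∀ {k l} → k ≤ l → U (+ k) → U (+ l)) →
              IsOrderIdeal n w (HeapLt n is) (λ x → Inv n w x × U (+ Σρ x)) ×
              ∃[ v ] (InPre n is v × ∀ a b → (InvPair n w a b × U (+ Σρ (a , b))) ⇔ InvPair n v a b)
  upper-set U? up =
    upper-set-ideal Σρ tally-heapLt n w _ up ,
    prefix-of-downset (U? ∘ +_ ∘ Σρ) (λ linked x-lab y-lab → up (<⇒≤ (tally-linked linked x-lab y-lab)))
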